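{- Let $M$ be a graph having $t\ge2$ connected components $M_1,\dots,M_t$, and set $G=\overline{M_1}\nabla\cdots\nabla\overline{M_t}$. Then $G$ has metamour graph $M$. In particular, if $M$ is $k$-regular for some $k\ge0$, then $G$ is $k$-metamour-regular.
   Context: All graphs are finite, simple and have at least one vertex; isomorphic graphs are regarded as equal. A vertex $v$ is a metamour of $w$ in $G$ if their distance in $G$ is $2$. The metamour graph of $G$ is the graph on $V(G)$ with an edge between $v,w$ whenever $v$ is a metamour of $w$. $G$ is $k$-metamour-regular if every vertex has exactly $k$ metamours. $\overline{H}$ is the complement of $H$; the join $G_1\nabla G_2$ of graphs with disjoint vertex sets has vertex set $V(G_1)\cup V(G_2)$ and edges $E(G_1)\cup E(G_2)$ plus all edges between $V(G_1)$ and $V(G_2)$ (associative and commutative). -}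

module Defs where

open import Data.Nat using (ℕ; zero; suc; _<_)
open import Data.Fin using (Fin)
open import Data.Bool using (Bool; true; false)
open import Data.List using (List; length)
open import Data.List.Membership.Propositional using (_∈_)
open import Data.List.Relation.Unary.Unique.Propositional using (Unique)
open import Data.Product using (Σ; ∃; ∃-syntax; _×_)
open import Data.Sum using (_⊎_)
open import Relation.Nullary using (¬_)
open import Relation.Binary.PropositionalEquality using (_≡_; _≢_)
open import Function.Bundles using (_⇔_)

record Graph (n : ℕ) : Set where
  field
    adj     : Fin n → Fin n → Bool
    adj-sym : ∀ u v → adj u v ≡ adj v u
    adj-irr : ∀ v → adj v v ≡ false
open Graph public

Edge : ∀ {n} → Graph n → Fin n → Fin n → Set
Edge G u v = adj G u v ≡ true

data Walk {n} (G : Graph n) : ℕ → Fin n → Fin n → Set where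
  here : ∀ {v} → Walk G zero v v
  step : ∀ {k u w v} → Edge G u w → Walk G k w v → Walk G (suc k) u v

Connected : ∀ {n} → Graph n → Fin n → Fin n → Set
Connected G u v = ∃[ k ] Walk G k u v

HasDist : ∀ {n} → Graph n → Fin n → Fin n → ℕ → Set
HasDist G u v d = Walk G d u v × (∀ k → k < d → ¬ Walk G k u v)

Metamour : ∀ {n} → Graph n → Fin n → Fin n → Set
Metamour G v w = HasDist G v w 2

HasSize : ∀ {n} → (Fin n → Set) → ℕ → Set
HasSize {n} P k =
  Σ (List (Fin n)) λ xs → length xs ≡ k × Unique xs × (∀ w → (w ∈ xs) ⇔ P w)

HasMetamourGraph : ∀ {n} → Graph n → Graph n → Set
HasMetamourGraph G M = ∀ v w → Metamour G v w ⇔ Edge M v w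

Regular : ∀ {n} → Graph n → ℕ → Set
Regular M k = ∀ v → HasSize (Edge M v) k

MetamourRegular : ∀ {n} → Graph n → ℕ → Set
MetamourRegular G k = ∀ v → HasSize (Metamour G v) k

AtLeastTwoComponents : ∀ {n} → Graph n → Set
AtLeastTwoComponents M = ∃[ u ] ∃[ v ] ¬ Connected M u v

-- G is the join of the complements of the connected components of M,
-- realised on the vertex set of M: vertices in different components are
-- adjacent (join edges), and distinct vertices in the same component are
-- adjacent iff they are non-adjacent in M (complement of that component).
IsJoinOfComplementsOfComponents : ∀ {n} → Graph n → Graph n → Set
IsJoinOfComplementsOfComponents M G =
  ∀ u v → Edge G u v ⇔
    ((¬ Connected M u v) ⊎ (Connected M u v × u ≢ v × ¬ Edge M u v))

-- Vertices in different components of M are adjacent in G, and two distinct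
-- vertices of one component are non-adjacent in G exactly when they are
-- adjacent in M. So a metamour pair lies in one component and is adjacent in M;
-- conversely an M-edge vw is a G-non-edge, and any vertex of a second component
-- is a common G-neighbour of v and w, so their G-distance is 2.
module Submission where

open import Defs
open import Data.Fin using (Fin)
open import Data.Nat using (ℕ; zero; suc; _<_; _+_; s≤s; z≤n)
open import Data.Fin.Properties using (any?)
open import Data.Bool using (true)
open import Data.Bool.Properties using () renaming (_≟_ to _≟ᵇ_)
open import Data.Product using (_×_; _,_; ∃-syntax)
open import Data.Sum using (inj₁; inj₂)
open import Relation.Nullary using (¬_; Dec)
open import Relation.Nullary.Decidable using (decidable-stable; _×-dec_)
open import Relation.Binary.PropositionalEquality using (_≢_; refl; sym; trans)
open import Function.Bundles using (_⇔_; mk⇔; Equivalence)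
open import Function.Construct.Composition using (_⇔-∘_)
open import Function.Construct.Symmetry using (⇔-sym)

module _ {n} (G : Graph n) where

  Edge? : ∀ u v → Dec (Edge G u v)
  Edge? u v = adj G u v ≟ᵇ true

  Edge-sym : ∀ {u v} → Edge G u v → Edge G v u
  Edge-sym {u} {v} e = trans (sym (adj-sym G u v)) e

  Edge⇒≢ : ∀ {u v} → Edge G u v → u ≢ v
  Edge⇒≢ {v = v} e refl with () ← trans (sym e) (adj-irr G v)

  Walk-snoc : ∀ {k u w v} → Walk G k u w → Edge G w v → Walk G (suc k) u v
  Walk-snoc here e = step e here
  Walk-snoc (step e p) e′ = step e (Walk-snoc p e′)

  Walk-reverse : ∀ {k u v} → Walk G k u v → Walk G k v u
  Walk-reverse here = here
  Walk-reverse (step e p) = Walk-snoc (Walk-reverse p) (Edge-sym e)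

  Walk-append : ∀ {k m u w v} → Walk G k u w → Walk G m w v → Walk G (k + m) u v
  Walk-append here q = q
  Walk-append (step e p) q = step e (Walk-append p q)

  Connected-sym : ∀ {u v} → Connected G u v → Connected G v u
  Connected-sym (k , p) = k , Walk-reverse p

  Connected-trans : ∀ {u w v} → Connected G u w → Connected G w v → Connected G u v
  Connected-trans (k , p) (m , q) = k + m , Walk-append p q

  Edge⇒Connected : ∀ {u v} → Edge G u v → Connected G u v
  Edge⇒Connected e = 1 , step e here

  CommonNeighbour : Fin n → Fin n → Set
  CommonNeighbour v w = ∃[ x ] Edge G v x × Edge G x w

  CommonNeighbour? : ∀ v w → Dec (CommonNeighbour v w)
  CommonNeighbour? v w = any? λ x → Edge? v x ×-dec Edge? x w

  CommonNeighbour⇒Metamour : ∀ {v w} → v ≢ w → ¬ Edge G v w →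
                             CommonNeighbour v w → Metamour G v w
  CommonNeighbour⇒Metamour v≢w ¬vw (x , vx , xw) = step vx (step xw here) , shorter
    where
    shorter : ∀ k → k < 2 → ¬ Walk G k _ _
    shorter zero _ here = v≢w refl
    shorter (suc zero) _ (step e here) = ¬vw e
    shorter (suc (suc _)) (s≤s (s≤s ())) _

  Metamour⇒≢ : ∀ {v w} → Metamour G v w → v ≢ w
  Metamour⇒≢ (_ , shorter) refl = shorter 0 (s≤s z≤n) here

  Metamour⇒¬Edge : ∀ {v w} → Metamour G v w → ¬ Edge G v w
  Metamour⇒¬Edge (_ , shorter) e = shorter 1 (s≤s (s≤s z≤n)) (step e here)

module _ {n} {M G : Graph n} (join : IsJoinOfComplementsOfComponents M G) where

  private
    join-edge : ∀ {u v} → ¬ Connected M u v → Edge G u v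
    join-edge ¬c = Equivalence.from (join _ _) (inj₁ ¬c)

    complement-edge : ∀ {u v} → Connected M u v → u ≢ v → ¬ Edge M u v → Edge G u v
    complement-edge c u≢v ¬e = Equivalence.from (join _ _) (inj₂ (c , u≢v , ¬e))

  Edgeᴳ⇒¬Edgeᴹ : ∀ {u v} → Edge G u v → ¬ Edge M u v
  Edgeᴳ⇒¬Edgeᴹ g e with Equivalence.to (join _ _) g
  ... | inj₁ ¬c = ¬c (Edge⇒Connected M e)
  ... | inj₂ (_ , _ , ¬e) = ¬e e

  ¬Edgeᴳ⇒Edgeᴹ : ∀ {u v} → u ≢ v → ¬ Edge G u v → Edge M u v
  ¬Edgeᴳ⇒Edgeᴹ u≢v ¬g = decidable-stable (Edge? M _ _) λ ¬e →
    ¬g (join-edge λ c → ¬g (complement-edge c u≢v ¬e))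

  outside-component⇒CommonNeighbour : ∀ {v w x} → Connected M v w → ¬ Connected M v x →
                                      Edge G v x × Edge G x w
  outside-component⇒CommonNeighbour c ¬c =
    join-edge ¬c , join-edge λ c′ → ¬c (Connected-trans M c (Connected-sym M c′))

  -- Some vertex lies outside the component of v, but constructively we cannot
  -- say which; since having a common neighbour is decidable, ¬¬ suffices.
  Connected⇒CommonNeighbour : AtLeastTwoComponents M → ∀ {v w} → Connected M v w →
                              CommonNeighbour G v w
  Connected⇒CommonNeighbour (x , y , ¬xy) {v} {w} c =
    decidable-stable (CommonNeighbour? G v w) λ none →
      reaches none x λ vx → reaches none y λ vy →
        ¬xy (Connected-trans M (Connected-sym M vx) vy)
    where
    reaches : ¬ CommonNeighbour G v w → ∀ z → ¬ ¬ Connected M v z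
    reaches none z ¬c = none (z , outside-component⇒CommonNeighbour c ¬c)

  join⇒HasMetamourGraph : AtLeastTwoComponents M → HasMetamourGraph G M
  join⇒HasMetamourGraph two v w = mk⇔
    (λ m → ¬Edgeᴳ⇒Edgeᴹ (Metamour⇒≢ G m) (Metamour⇒¬Edge G m))
    (λ e → CommonNeighbour⇒Metamour G (Edge⇒≢ M e) (λ g → Edgeᴳ⇒¬Edgeᴹ g e)
             (Connected⇒CommonNeighbour two (Edge⇒Connected M e)))

HasSize-cong : ∀ {n} {P Q : Fin n → Set} {k} → (∀ w → P w ⇔ Q w) → HasSize P k → HasSize Q k
HasSize-cong P⇔Q (xs , length≡k , unique , ∈⇔P) = xs , length≡k , unique , λ w → P⇔Q w ⇔-∘ ∈⇔P w

HasMetamourGraph⇒MetamourRegular : ∀ {n} (G M : Graph n) → HasMetamourGraph G M →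
                                   ∀ k → Regular M k → MetamourRegular G k
HasMetamourGraph⇒MetamourRegular G M metamour k regular v =
  HasSize-cong (λ w → ⇔-sym (metamour v w)) (regular v)

proposition3p19 : ∀ {n} (M G : Graph n) →
    AtLeastTwoComponents M →
    IsJoinOfComplementsOfComponents M G →
    HasMetamourGraph G M × (∀ (k : ℕ) → Regular M k → MetamourRegular G k)
proposition3p19 M G two join =
  metamour , HasMetamourGraph⇒MetamourRegular G M metamour
  where
  metamour : HasMetamourGraph G M
  metamour = join⇒HasMetamourGraph join two
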